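{- Let $k,n$ be positive integers and $m\ge3$ an integer satisfying $\bar{t}_{m-1}(n)>\frac1k\binom{n}{2}$. Then $\bar{R}(m;k)\le n$.
   Context: For integers $s\ge2$ and $N\ge0$, write $N=sq+r$ with $0\le r<s$; $\bar{T}_s(N)$ is the graph $rK_{q+1}\cup(s-r)K_q$ (disjoint union of cliques), and $\bar{t}_s(N)=r\binom{q+1}{2}+(s-r)\binom{q}{2}$ is its number of edges. $[n]=\{1,\dots,n\}$; an edge-coloring of $K_n$ with $k$ colors is a map $f:\binom{[n]}{2}\to[k]$, and $\alpha_i(f)$ is the independence number of the graph on $[n]$ whose edges are the pairs of color $i$. $\bar{R}(m_1,\dots,m_k)$ is the least positive integer $n$ such that every edge-coloring $f$ of $K_n$ with $k$ colors has some $i$ with $\alpha_i(f)\ge m_i$; $\bar{R}(m;k)$ denotes $\bar{R}(m,\dots,m)$ with $k$ arguments. -}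

module Defs where

open import Data.Nat using (ℕ; zero; suc; _+_; _*_; _∸_; _≤_; _<_; NonZero)
open import Data.Nat.DivMod using (_/_; _%_)
open import Data.Nat.Combinatorics using (_C_)
open import Data.Fin using (Fin)
open import Data.Product using (Σ; ∃; _×_)
open import Relation.Binary.PropositionalEquality using (_≡_; _≢_)

tbar : (s N : ℕ) → .{{NonZero s}} → ℕ
tbar s N = r * ((suc q) C 2) + (s ∸ r) * (q C 2)
  where
  q = N / s
  r = N % s

-- An edge-coloring of K_n with k colors: a map on unordered pairs {x,y}, x ≠ y,
-- represented as a symmetric function on Fin n × Fin n (diagonal values are ignored).
record Coloring (n k : ℕ) : Set where
  field
    col : Fin n → Fin n → Fin k
    sym : ∀ x y → col x y ≡ col y x
open Coloring public

αAtLeast : {n k : ℕ} → Coloring n k → Fin k → ℕ → Set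
αAtLeast {n} f i m =
  Σ (Fin m → Fin n) λ g →
    (∀ a b → g a ≡ g b → a ≡ b) ×
    (∀ a b → a ≢ b → col f (g a) (g b) ≢ i)

RamseyProp : (m k N : ℕ) → Set
RamseyProp m k N = (f : Coloring N k) → ∃ λ (i : Fin k) → αAtLeast f i m

-- R̄(m;k) ≤ n : the least positive N with RamseyProp m k N is at most n,
-- i.e. some positive N ≤ n has the property.
RbarLe : (m k n : ℕ) → Set
RbarLe m k n = Σ ℕ λ N → (1 ≤ N) × (N ≤ n) × RamseyProp m k N

-- t̄_{m-1}(N); for m ≤ 1 (never used, since m ≥ 3) we return 0.
tbarPred : (m N : ℕ) → ℕ
tbarPred zero N = 0
tbarPred (suc zero) N = 0
tbarPred (suc (suc s)) N = tbar (suc s) N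

-- A colouring of K_n splits its C(n,2) edges among k colour classes; since C(n,2) < k·t̄_{m-1}(n),
-- some class has fewer than t̄_{m-1}(n) edges.  Such a graph has an independent set of size m
-- (Turán's theorem in complementary form), by induction on the number of vertices: delete a vertex v
-- of maximum degree Δ.  If n > (m-1)(Δ+1), choosing vertices greedily and discarding their neighbours
-- gives m independent vertices; otherwise Δ ≥ ⌊(n-1)/(m-1)⌋ = t̄_{m-1}(n) − t̄_{m-1}(n-1), and the
-- induction hypothesis for the remaining n-1 vertices applies.
module Submission where

open import Defs hiding (sym)
open import Data.Nat using (ℕ; _*_; _≤_; _<_)
open import Data.Nat.Combinatorics using (_C_)

open import Level using (Level; 0ℓ; _⊔_)
open import Function using (_∘_)
open import Data.Nat using (zero; suc; _+_; _∸_; z≤n; s≤s; NonZero; _<?_; >-nonZero⁻¹)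
open import Data.Nat.Properties
  using ( +-0-commutativeMonoid; +-commutativeSemigroup; +-comm; +-suc; +-identityʳ; *-comm; *-zeroʳ
        ; +-∸-assoc; m+n∸n≡m; suc-injective; ≤-refl; ≤-reflexive; ≤-trans; ≤-<-trans; ≤-pred; <⇒≤pred
        ; n<1+n; ≮⇒≥; <⇒≱; m≤n⇒m<n∨m≡n; m≤n+m; +-mono-≤; +-monoˡ-≤; +-monoʳ-≤; +-cancelˡ-<; +-cancelʳ-≤
        ; module ≤-Reasoning )
open import Data.Nat.DivMod
  using ( _/_; _%_; m≡m%n+[m/n]*n; m%n<n; [m+kn]%n≡m%n; m<n⇒m%n≡m; +-distrib-/-∣ʳ; m<n⇒m/n≡0; m*n/n≡m
        ; m<n*o⇒m/o<n )
open import Algebra.Properties.CommutativeSemigroup +-commutativeSemigroup using (x∙yz≈y∙xz; interchange)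
open import Data.Nat.Divisibility using (divides-refl)
open import Data.Nat.Combinatorics using (nCk+nC[k+1]≡[n+1]C[k+1]; nC1≡n)
open import Data.Nat.Tactic.RingSolver using (solve-∀)
open import Data.Fin using (Fin; zero; suc; punchIn; _≟_)
open import Data.Fin.Properties using (punchInᵢ≢i)
open import Data.Vec.Functional as Vector using ()
open import Algebra.Properties.CommutativeMonoid.Sum +-0-commutativeMonoid
  using (sum; sum-remove; sum-cong-≗; sum-replicate-zero; ∑-distrib-+)
open import Data.List using (List; []; _∷_; length; filter; allFin)
open import Data.List.Properties using (length-removeAt′; length-tabulate)
open import Data.List.Membership.Propositional using (_∈_)
open import Data.List.Membership.Propositional.Properties using (∈-filter⁻)
open import Data.List.Relation.Unary.Any as Any using (here; there; _─_; index)
open import Data.List.Relation.Unary.All as All using (All; []; _∷_)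
open import Data.List.Relation.Unary.AllPairs using (AllPairs; []; _∷_)
open import Data.List.Relation.Unary.Unique.Propositional using (Unique)
open import Data.List.Relation.Unary.Unique.Propositional.Properties as Unique using (allFin⁺)
open import Data.List.Relation.Binary.Sublist.Propositional using (_⊆_; []; _∷_; _∷ʳ_; ⊆-refl)
open import Data.List.Relation.Binary.Sublist.Propositional.Properties using (All-resp-⊆; Any-resp-⊆; filter-⊆)
open import Data.List.Extrema.Nat using (argmax; argmax-sel; f[⊥]≤f[argmax]; f[xs]≤f[argmax])
open import Data.Product using (Σ; ∃; _×_; _,_; proj₁; proj₂)
open import Data.Sum using (_⊎_; inj₁; inj₂; [_,_]′)
import Data.Sum as Sum
open import Data.Empty using (⊥-elim)
open import Relation.Nullary using (¬_; Dec; yes; no; ¬?; _×-dec_)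
open import Relation.Nullary.Decidable using (decidable-stable)
open import Relation.Binary using (Rel; Decidable; Symmetric)
open import Relation.Binary.PropositionalEquality as ≡ using (_≡_; _≢_; refl; cong; cong₂; module ≡-Reasoning)

private variable
  a ℓ p q : Level
  A : Set a
  P : Set p
  Q : Set q

indicator : Dec P → ℕ
indicator (yes _) = 1
indicator (no _) = 0

indicator-yes : (p? : Dec P) → P → indicator p? ≡ 1
indicator-yes (yes _) _ = refl
indicator-yes (no ¬p) p = ⊥-elim (¬p p)

indicator-no : (p? : Dec P) → ¬ P → indicator p? ≡ 0
indicator-no (yes p) ¬p = ⊥-elim (¬p p)
indicator-no (no _) _ = refl

indicator-↔ : (p? : Dec P) (q? : Dec Q) → (P → Q) → (Q → P) → indicator p? ≡ indicator q?
indicator-↔ (yes _) (yes _) _ _ = refl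
indicator-↔ (yes p) (no ¬q) P→Q _ = ⊥-elim (¬q (P→Q p))
indicator-↔ (no ¬p) (yes q) _ Q→P = ⊥-elim (¬p (Q→P q))
indicator-↔ (no _) (no _) _ _ = refl

sum-indicator-≟ : ∀ {k} (c : Fin k) → sum (λ i → indicator (c ≟ i)) ≡ 1
sum-indicator-≟ {suc k} c = begin
  sum (λ i → indicator (c ≟ i))                        ≡⟨ sum-remove {i = c} (λ i → indicator (c ≟ i)) ⟩
  indicator (c ≟ c) + sum (λ j → indicator (c ≟ punchIn c j))
    ≡⟨ cong₂ _+_ (indicator-yes (c ≟ c) refl) (sum-cong-≗ (λ j → indicator-no (c ≟ punchIn c j) (punchInᵢ≢i c j ∘ ≡.sym))) ⟩
  1 + sum (Vector.replicate k 0)                       ≡⟨ cong (1 +_) (sum-replicate-zero k) ⟩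
  1                                                    ∎
  where open ≡-Reasoning

sum<*⇒∃< : ∀ {k} (f : Fin k → ℕ) T → sum f < k * T → ∃ λ i → f i < T
sum<*⇒∃< {suc k} f T sum<k*T with f zero <? T
... | yes f₀<T = zero , f₀<T
... | no f₀≮T =
  let i , fᵢ<T = sum<*⇒∃< (f ∘ suc) T (+-cancelˡ-< T (sum (f ∘ suc)) (k * T)
                   (≤-<-trans (+-monoˡ-≤ _ (≮⇒≥ f₀≮T)) sum<k*T))
  in suc i , fᵢ<T

[1+n]C2≡n+nC2 : ∀ n → suc n C 2 ≡ n + n C 2
[1+n]C2≡n+nC2 n = ≡.trans (≡.sym (nCk+nC[k+1]≡[n+1]C[k+1] n 1)) (cong (_+ n C 2) (nC1≡n n))

tbar-divMod : ∀ s .{{_ : NonZero s}} {q r} → r < s →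
              tbar s (r + q * s) ≡ r * (suc q C 2) + (s ∸ r) * (q C 2)
tbar-divMod s {q} {r} r<s = cong₂ (λ r′ q′ → r′ * (suc q′ C 2) + (s ∸ r′) * (q′ C 2)) remainder quotient
  where
  open ≡-Reasoning
  remainder : (r + q * s) % s ≡ r
  remainder = ≡.trans ([m+kn]%n≡m%n r q s) (m<n⇒m%n≡m r<s)
  quotient : (r + q * s) / s ≡ q
  quotient = begin
    (r + q * s) / s    ≡⟨ +-distrib-/-∣ʳ r (divides-refl q) ⟩
    r / s + q * s / s  ≡⟨ cong₂ _+_ (m<n⇒m/n≡0 r<s) (m*n/n≡m q s) ⟩
    q                  ∎

tbar-zero : ∀ s .{{_ : NonZero s}} → tbar s 0 ≡ 0
tbar-zero s = ≡.trans (tbar-divMod s {0} (>-nonZero⁻¹ s)) (*-zeroʳ s)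

-- Passing from r·K_{q+1} ∪ (w+1)·K_q to (r+1)·K_{q+1} ∪ w·K_q enlarges one q-clique, adding q edges.
grow-clique : ∀ r q w → suc r * (suc q C 2) + w * (q C 2) ≡ r * (suc q C 2) + suc w * (q C 2) + q
grow-clique r q w = begin
  suc r * (suc q C 2) + w * (q C 2)        ≡⟨ cong (λ c → suc r * c + w * (q C 2)) ([1+n]C2≡n+nC2 q) ⟩
  suc r * (q + q C 2) + w * (q C 2)        ≡⟨ identity r q (q C 2) w ⟩
  r * (q + q C 2) + suc w * (q C 2) + q    ≡⟨ cong (λ c → r * c + suc w * (q C 2) + q) ([1+n]C2≡n+nC2 q) ⟨
  r * (suc q C 2) + suc w * (q C 2) + q    ∎
  where
  open ≡-Reasoning
  identity : ∀ r q c w → suc r * (q + c) + w * c ≡ r * (q + c) + suc w * c + q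
  identity = solve-∀

tbar-suc-divMod : ∀ s .{{_ : NonZero s}} {q r} → r < s →
                  tbar s (suc (r + q * s)) ≡ tbar s (r + q * s) + q
tbar-suc-divMod s {q} {r} r<s with m≤n⇒m<n∨m≡n r<s
... | inj₁ 1+r<s = begin
  tbar s (suc r + q * s)                           ≡⟨ tbar-divMod s {q} 1+r<s ⟩
  suc r * (suc q C 2) + (s ∸ suc r) * (q C 2)      ≡⟨ grow-clique r q (s ∸ suc r) ⟩
  r * (suc q C 2) + suc (s ∸ suc r) * (q C 2) + q  ≡⟨ cong (λ w → r * (suc q C 2) + w * (q C 2) + q) (≡.sym (+-∸-assoc 1 r<s)) ⟩
  r * (suc q C 2) + (s ∸ r) * (q C 2) + q          ≡⟨ cong (_+ q) (≡.sym (tbar-divMod s {q} r<s)) ⟩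
  tbar s (r + q * s) + q                           ∎
  where open ≡-Reasoning
... | inj₂ refl = begin
  tbar s (0 + suc q * s)                           ≡⟨ tbar-divMod s {suc q} (>-nonZero⁻¹ s) ⟩
  s * (suc q C 2)                                  ≡⟨ +-identityʳ _ ⟨
  s * (suc q C 2) + 0 * (q C 2)                    ≡⟨ grow-clique r q 0 ⟩
  r * (suc q C 2) + 1 * (q C 2) + q                ≡⟨ cong (λ w → r * (suc q C 2) + w * (q C 2) + q) (≡.sym (m+n∸n≡m 1 r)) ⟩
  r * (suc q C 2) + (s ∸ r) * (q C 2) + q          ≡⟨ cong (_+ q) (≡.sym (tbar-divMod s {q} r<s)) ⟩
  tbar s (r + q * s) + q                           ∎
  where open ≡-Reasoning

tbar-suc : ∀ s .{{_ : NonZero s}} n → tbar s (suc n) ≡ tbar s n + n / s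
tbar-suc s n = begin
  tbar s (suc n)                           ≡⟨ cong (λ m → tbar s (suc m)) n≡r+qs ⟩
  tbar s (suc (n % s + n / s * s))         ≡⟨ tbar-suc-divMod s (m%n<n n s) ⟩
  tbar s (n % s + n / s * s) + n / s       ≡⟨ cong (λ m → tbar s m + n / s) (≡.sym n≡r+qs) ⟩
  tbar s n + n / s                         ∎
  where
  open ≡-Reasoning
  n≡r+qs = m≡m%n+[m/n]*n n s

AllPairs-resp-⊇ : {R : Rel A ℓ} {xs ys : List A} → xs ⊆ ys → AllPairs R ys → AllPairs R xs
AllPairs-resp-⊇ [] [] = []
AllPairs-resp-⊇ (_ ∷ʳ xs⊆ys) (_ ∷ pairs) = AllPairs-resp-⊇ xs⊆ys pairs
AllPairs-resp-⊇ (refl ∷ xs⊆ys) (rel ∷ pairs) = All-resp-⊆ xs⊆ys rel ∷ AllPairs-resp-⊇ xs⊆ys pairs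

─-⊆ : ∀ {x : A} {xs} (x∈xs : x ∈ xs) → (xs ─ x∈xs) ⊆ xs
─-⊆ {xs = _ ∷ _} (here _) = _ ∷ʳ ⊆-refl
─-⊆ (there x∈xs) = refl ∷ ─-⊆ x∈xs

Pairwise : Rel A ℓ → ∀ {t} → (Fin t → A) → Set ℓ
Pairwise R g = ∀ {a b} → a ≢ b → R (g a) (g b)

Pairwise-∷ : {R : Rel A ℓ} → Symmetric R → ∀ {t x} {g : Fin t → A} →
             (∀ b → R x (g b)) → Pairwise R g → Pairwise R (x Vector.∷ g)
Pairwise-∷ _ _ _ {zero} {zero} 0≢0 = ⊥-elim (0≢0 refl)
Pairwise-∷ _ x~g _ {zero} {suc b} _ = x~g b
Pairwise-∷ sym x~g _ {suc a} {zero} _ = sym (x~g a)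
Pairwise-∷ _ _ pairwise {suc a} {suc b} a≢b = pairwise (a≢b ∘ cong suc)

module Graph {A : Set a} {_~_ : Rel A ℓ} (_~?_ : Decidable _~_) where

  degree : A → List A → ℕ
  degree v [] = 0
  degree v (u ∷ W) = indicator (v ~? u) + degree v W

  edges : List A → ℕ
  edges [] = 0
  edges (v ∷ W) = degree v W + edges W

  nonNeighbours : A → List A → List A
  nonNeighbours v = filter (¬? ∘ (v ~?_))

  DegreeBounded : ℕ → List A → Set a
  DegreeBounded D V = All (λ u → degree u V ≤ D) V

  Apart : Rel A (a ⊔ ℓ)
  Apart x y = x ≢ y × ¬ x ~ y

  Independent : ℕ → List A → Set (a ⊔ ℓ)
  Independent t V = Σ (Fin t → A) λ g → (∀ i → g i ∈ V) × Pairwise Apart g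

  degree-mono : ∀ {v W V} → W ⊆ V → degree v W ≤ degree v V
  degree-mono [] = z≤n
  degree-mono (_ ∷ʳ W⊆V) = ≤-trans (degree-mono W⊆V) (m≤n+m _ _)
  degree-mono (refl ∷ W⊆V) = +-monoʳ-≤ _ (degree-mono W⊆V)

  degree-─ : ∀ {u v V} (v∈V : v ∈ V) → degree u V ≡ indicator (u ~? v) + degree u (V ─ v∈V)
  degree-─ (here refl) = refl
  degree-─ {u} {v} {w ∷ W} (there v∈W) = ≡.trans (cong (indicator (u ~? w) +_) (degree-─ v∈W))
    (x∙yz≈y∙xz (indicator (u ~? w)) (indicator (u ~? v)) _)

  length-nonNeighbours : ∀ v W → length (nonNeighbours v W) + degree v W ≡ length W
  length-nonNeighbours v [] = refl
  length-nonNeighbours v (u ∷ W) with v ~? u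
  ... | yes _ = ≡.trans (+-suc _ _) (cong suc (length-nonNeighbours v W))
  ... | no _ = cong suc (length-nonNeighbours v W)

  DegreeBounded-⊇ : ∀ {D W V} → W ⊆ V → DegreeBounded D V → DegreeBounded D W
  DegreeBounded-⊇ W⊆V bounded = All-resp-⊆ W⊆V (All.map (≤-trans (degree-mono W⊆V)) bounded)

  Independent-⊆ : ∀ {t W V} → W ⊆ V → Independent t W → Independent t V
  Independent-⊆ W⊆V (g , g∈W , apart) = g , Any-resp-⊆ W⊆V ∘ g∈W , apart

  Independent-zero : ∀ {V} → Independent 0 V
  Independent-zero = (λ ()) , (λ ()) , λ { {()} }

  module _ (~-sym : Symmetric _~_) (~-irrefl : ∀ {x} → ¬ x ~ x) where

    degree-∷-self : ∀ v W → degree v (v ∷ W) ≡ degree v W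
    degree-∷-self v W = cong (_+ degree v W) (indicator-no (v ~? v) ~-irrefl)

    edges-─ : ∀ {v V} (v∈V : v ∈ V) → edges V ≡ degree v V + edges (V ─ v∈V)
    edges-─ {v} {v ∷ W} (here refl) = cong (_+ edges W) (≡.sym (degree-∷-self v W))
    edges-─ {v} {w ∷ W} (there v∈W) = begin
      degree w W + edges W
        ≡⟨ cong₂ _+_ (degree-─ v∈W) (edges-─ v∈W) ⟩
      (indicator (w ~? v) + degree w R) + (degree v W + edges R)
        ≡⟨ interchange (indicator (w ~? v)) (degree w R) (degree v W) (edges R) ⟩
      (indicator (w ~? v) + degree v W) + (degree w R + edges R)
        ≡⟨ cong (λ x → x + degree v W + (degree w R + edges R)) (indicator-↔ (w ~? v) (v ~? w) ~-sym ~-sym) ⟩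
      (indicator (v ~? w) + degree v W) + (degree w R + edges R)
        ∎
      where
      open ≡-Reasoning
      R = W ─ v∈W

    Apart-sym : Symmetric Apart
    Apart-sym (x≢y , x≁y) = x≢y ∘ ≡.sym , x≁y ∘ ~-sym

    Independent-∷ : ∀ {t v W} → All (v ≢_) W → Independent t (nonNeighbours v W) → Independent (suc t) (v ∷ W)
    Independent-∷ {v = v} {W} v∉W (g , g∈ , apart) = v Vector.∷ g , member , Pairwise-∷ {R = Apart} Apart-sym v-apart apart
      where
      member : ∀ i → (v Vector.∷ g) i ∈ v ∷ W
      member zero = here refl
      member (suc i) = there (proj₁ (∈-filter⁻ (¬? ∘ (v ~?_)) (g∈ i)))
      v-apart : ∀ i → Apart v (g i)
      v-apart i with ∈-filter⁻ (¬? ∘ (v ~?_)) (g∈ i)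
      ... | gᵢ∈W , v≁gᵢ = All.lookup v∉W gᵢ∈W , v≁gᵢ

    greedy : ∀ D t V → Unique V → DegreeBounded D V → t * suc D < length V → Independent (suc t) V
    greedy D zero (v ∷ W) (v∉W ∷ _) _ _ = Independent-∷ v∉W Independent-zero
    greedy D (suc t) (v ∷ W) (v∉W ∷ W!) (dv ∷ bounded) 1+t*1+D<1+W =
      Independent-∷ v∉W (greedy D t V′ (Unique.filter⁺ (¬? ∘ (v ~?_)) W!) bounded′ t*1+D<V′)
      where
      V′ = nonNeighbours v W
      bounded′ : DegreeBounded D V′
      bounded′ = DegreeBounded-⊇ (v ∷ʳ filter-⊆ (¬? ∘ (v ~?_)) W) (dv ∷ bounded)
      t*1+D<V′ : t * suc D < length V′
      t*1+D<V′ = +-cancelʳ-≤ D (suc (t * suc D)) (length V′) (begin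
        suc (t * suc D) + D     ≡⟨ cong suc (+-comm (t * suc D) D) ⟩
        suc D + t * suc D       ≤⟨ ≤-pred 1+t*1+D<1+W ⟩
        length W                ≡⟨ length-nonNeighbours v W ⟨
        length V′ + degree v W  ≤⟨ +-monoʳ-≤ (length V′) (≤-trans (≤-reflexive (≡.sym (degree-∷-self v W))) dv) ⟩
        length V′ + D           ∎)
        where open ≤-Reasoning

    maxDegreeVertex : ∀ w W → ∃ λ v → v ∈ w ∷ W × DegreeBounded (degree v (w ∷ W)) (w ∷ W)
    maxDegreeVertex w W = v , [ here , there ]′ (argmax-sel d w W)
                            , f[⊥]≤f[argmax] {f = d} w W ∷ f[xs]≤f[argmax] {f = d} w W
      where
      d = λ u → degree u (w ∷ W)
      v = argmax d w W

    turán : ∀ s .{{_ : NonZero s}} V → Unique V → Independent (suc s) V ⊎ tbar s (length V) ≤ edges V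
    turán s V = go (length V) V refl
      where
      go : ∀ n V → length V ≡ n → Unique V → Independent (suc s) V ⊎ tbar s n ≤ edges V
      go zero V _ _ = inj₂ (≤-trans (≤-reflexive (tbar-zero s)) z≤n)
      go (suc n) V@(w ∷ W) |V|≡1+n V! with maxDegreeVertex w W
      ... | v , v∈V , bounded with s * suc (degree v V) <? length V
      ...   | yes large = inj₁ (greedy _ s V V! bounded large)
      ...   | no small = Sum.map (Independent-⊆ (─-⊆ v∈V)) extend
                           (go n (V ─ v∈V) (suc-injective (≡.trans (≡.sym (length-removeAt′ V (index v∈V))) |V|≡1+n))
                               (AllPairs-resp-⊇ (─-⊆ v∈V) V!))
        where
        Δ = degree v V
        n/s≤Δ : n / s ≤ Δ
        n/s≤Δ = <⇒≤pred (m<n*o⇒m/o<n (begin-strict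
          n             <⟨ n<1+n n ⟩
          suc n         ≡⟨ |V|≡1+n ⟨
          length V      ≤⟨ ≮⇒≥ small ⟩
          s * suc Δ     ≡⟨ *-comm s (suc Δ) ⟩
          suc Δ * s     ∎))
          where open ≤-Reasoning
        extend : tbar s n ≤ edges (V ─ v∈V) → tbar s (suc n) ≤ edges V
        extend ih = begin
          tbar s (suc n)              ≡⟨ tbar-suc s n ⟩
          tbar s n + n / s            ≤⟨ +-mono-≤ ih n/s≤Δ ⟩
          edges (V ─ v∈V) + Δ         ≡⟨ +-comm _ Δ ⟩
          Δ + edges (V ─ v∈V)         ≡⟨ edges-─ v∈V ⟨
          edges V                     ∎
          where open ≤-Reasoning

length-allFin : ∀ n → length (allFin n) ≡ n
length-allFin n = length-tabulate (λ i → i)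

module _ {N k : ℕ} (f : Coloring N k) where

  -- x ≢ y is needed because col is also defined, meaninglessly, on the diagonal.
  ColourAdj : Fin k → Rel (Fin N) 0ℓ
  ColourAdj i x y = x ≢ y × col f x y ≡ i

  colourAdj? : ∀ i → Decidable (ColourAdj i)
  colourAdj? i x y = ¬? (x ≟ y) ×-dec (col f x y ≟ i)

  colourAdj-sym : ∀ {i} → Symmetric (ColourAdj i)
  colourAdj-sym (x≢y , cxy≡i) = x≢y ∘ ≡.sym , ≡.trans (Coloring.sym f _ _) cxy≡i

  colourAdj-irrefl : ∀ {i x} → ¬ ColourAdj i x x
  colourAdj-irrefl (x≢x , _) = x≢x refl

  open Graph using (degree; edges; Independent)

  sum-degree : ∀ {v W} → All (v ≢_) W → sum (λ i → degree (colourAdj? i) v W) ≡ length W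
  sum-degree [] = sum-replicate-zero k
  sum-degree {v} {u ∷ W} (v≢u ∷ v∉W) = begin
    sum (λ i → indicator (colourAdj? i v u) + degree (colourAdj? i) v W)
      ≡⟨ ∑-distrib-+ (λ i → indicator (colourAdj? i v u)) (λ i → degree (colourAdj? i) v W) ⟩
    sum (λ i → indicator (colourAdj? i v u)) + sum (λ i → degree (colourAdj? i) v W)
      ≡⟨ cong (_+ _) (sum-cong-≗ (λ i → indicator-↔ (colourAdj? i v u) (col f v u ≟ i) proj₂ (v≢u ,_))) ⟩
    sum (λ i → indicator (col f v u ≟ i)) + sum (λ i → degree (colourAdj? i) v W)
      ≡⟨ cong₂ _+_ (sum-indicator-≟ (col f v u)) (sum-degree v∉W) ⟩
    suc (length W)
      ∎
    where open ≡-Reasoning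

  sum-edges : ∀ {V} → Unique V → sum (λ i → edges (colourAdj? i) V) ≡ length V C 2
  sum-edges [] = sum-replicate-zero k
  sum-edges {v ∷ W} (v∉W ∷ W!) = begin
    sum (λ i → degree (colourAdj? i) v W + edges (colourAdj? i) W)
      ≡⟨ ∑-distrib-+ (λ i → degree (colourAdj? i) v W) (λ i → edges (colourAdj? i) W) ⟩
    sum (λ i → degree (colourAdj? i) v W) + sum (λ i → edges (colourAdj? i) W)
      ≡⟨ cong₂ _+_ (sum-degree v∉W) (sum-edges W!) ⟩
    length W + length W C 2
      ≡⟨ [1+n]C2≡n+nC2 (length W) ⟨
    suc (length W) C 2
      ∎
    where open ≡-Reasoning

  sum-edges-allFin : sum (λ i → edges (colourAdj? i) (allFin N)) ≡ N C 2
  sum-edges-allFin = ≡.trans (sum-edges (allFin⁺ N)) (cong (_C 2) (length-allFin N))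

  Independent⇒αAtLeast : ∀ {i t V} → Independent (colourAdj? i) t V → αAtLeast f i t
  Independent⇒αAtLeast (g , _ , apart) = g , injective , λ a b a≢b → proj₂ (apart a≢b) ∘ (proj₁ (apart a≢b) ,_)
    where
    injective : ∀ a b → g a ≡ g b → a ≡ b
    injective a b ga≡gb = decidable-stable (a ≟ b) (λ a≢b → proj₁ (apart a≢b) ga≡gb)

  sparse⇒αAtLeast : ∀ s .{{_ : NonZero s}} i → edges (colourAdj? i) (allFin N) < tbar s N → αAtLeast f i (suc s)
  sparse⇒αAtLeast s i sparse with Graph.turán (colourAdj? i) colourAdj-sym colourAdj-irrefl s (allFin N) (allFin⁺ N)
  ... | inj₁ independent = Independent⇒αAtLeast independent
  ... | inj₂ dense = ⊥-elim (<⇒≱ sparse (≡.subst (λ m → tbar s m ≤ edges (colourAdj? i) (allFin N)) (length-allFin N) dense))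

lemma4p3 : (k n m : ℕ) → 1 ≤ k → 1 ≤ n → 3 ≤ m →
    n C 2 < k * tbarPred m n →
    RbarLe m k n
lemma4p3 k n (suc (suc s)) _ 1≤n _ nC2<k*tbar = n , 1≤n , ≤-refl , ramsey
  where
  ramsey : RamseyProp (suc (suc s)) k n
  ramsey f =
    let i , sparse = sum<*⇒∃< (λ i → Graph.edges (colourAdj? f i) (allFin n)) (tbar (suc s) n)
                       (≡.subst (_< k * tbar (suc s) n) (≡.sym (sum-edges-allFin f)) nC2<k*tbar)
    in i , sparse⇒αAtLeast f (suc s) i sparse
lemma4p3 k n 0 _ _ () _
lemma4p3 k n 1 _ _ (s≤s ()) _
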